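{- Let $n\ge t\ge 2$ and $m$ be positive integers, and suppose that the relation $(n,m)\rightarrow(t,2^t-2^{t-2}+1)$ holds. Then every family $\mathcal{F}$ of subsets of an $n$-element set with $|\mathcal{F}|\ge m$ is $t$-separable.
   Context: The relation $(n,m)\rightarrow(a,b)$ means: for every family $\mathcal{F}=\{F_1,\ldots,F_m\}$ of $m$ subsets of an $n$-element set $X$, there is $T\subset X$ with $|T|=a$ such that the family of traces $\{F_1\cap T,\ldots,F_m\cap T\}$ has at least $b$ distinct members. A family $\mathcal{F}\subset 2^X$ is called $t$-separable if there is a $t$-element subset $T\subset X$ such that for every ordered pair $x,y\in T$ with $x\neq y$ there exists $F\in\mathcal{F}$ with $F\cap\{x,y\}=\{x\}$. -}

module Defs where

open import Data.Nat using (ℕ; _∸_; _^_; _+_; _≤_)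
open import Data.Fin using (Fin)
open import Data.Fin.Subset using (Subset; _∩_; _∈_; _∉_; ∣_∣)
open import Data.Product using (Σ; ∃; _×_)
open import Relation.Binary.PropositionalEquality using (_≡_; _≢_)

-- The ground set X is Fin n.  A family of k subsets of X is an injective
-- indexing F : Fin k → Subset n (injective: the k members are distinct).
IsFamily : {n k : ℕ} → (Fin k → Subset n) → Set
IsFamily {k = k} F = (i j : Fin k) → F i ≡ F j → i ≡ j

AtLeastDistinctTraces : {n k : ℕ} → (Fin k → Subset n) → Subset n → ℕ → Set
AtLeastDistinctTraces {n} {k} F T b =
  Σ (Fin b → Fin k) λ g → (i j : Fin b) → F (g i) ∩ T ≡ F (g j) ∩ T → i ≡ j

Arrow : ℕ → ℕ → ℕ → ℕ → Set
Arrow n m a b =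
  (F : Fin m → Subset n) → IsFamily F →
  Σ (Subset n) λ T → (∣ T ∣ ≡ a) × AtLeastDistinctTraces F T b

Separable : {n k : ℕ} → ℕ → (Fin k → Subset n) → Set
Separable {n} {k} t F =
  Σ (Subset n) λ T → (∣ T ∣ ≡ t) ×
    ((x y : Fin n) → x ∈ T → y ∈ T → x ≢ y →
      Σ (Fin k) λ i → (x ∈ F i) × (y ∉ F i))

-- Let T be a t-set on which the traces of F take at least 2^t − 2^(t−2) + 1
-- values, and suppose no member of F separates x from y in T, i.e. every trace
-- containing x also contains y.  A trace is determined by its restriction to
-- T ∖ {x, y} and by its pattern on {x, y}, of which only three remain, so there
-- are at most 3 · 2^(t−2) = 2^t − 2^(t−2) traces: a contradiction.
module Submission where

open import Defs
open import Data.Nat using (ℕ; _≤_; _^_; _∸_; _+_)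
open import Data.Fin using (Fin)
open import Data.Fin.Subset using (Subset)

open import Data.Bool using (Bool; true; false)
open import Data.Vec using ([]; _∷_)
open import Data.Bool.Properties using (∧-zeroʳ; ∧-identityʳ)
open import Data.Empty using (⊥-elim)
open import Data.Fin using (zero; suc; combine; inject≤)
open import Data.Fin.Properties
  using (_≟_; any?; injective⇒≤; combine-injective; inject≤-injective)
open import Data.Fin.Subset using (outside; inside; _∩_; _∈_; _∉_; _⊆_; _-_; ∣_∣)
open import Data.Fin.Subset.Properties
  using (_∈?_; ⊆-antisym; x∈p∩q⁺; x∈p∩q⁻; x∈p∧x≢y⇒x∈p-y; x∈p⇒∣p-x∣<∣p∣)
open import Data.Nat as ℕ using (suc; _*_; s≤s)
open import Data.Nat.Properties
  using (≤-trans; <-irrefl; *-monoʳ-≤; ^-monoʳ-≤; m+n∸m≡n; +-comm; n<1+n; module ≤-Reasoning)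
open import Data.Nat.Tactic.RingSolver using (solve-∀)
open import Data.Product using (Σ; _×_; _,_; proj₁; proj₂)
open import Data.Sum using (_⊎_; inj₁; inj₂)
open import Function using (_∘_; Injective)
open import Relation.Nullary using (yes; no)
open import Relation.Nullary.Decidable using (_×-dec_; ¬?; decidable-stable)
open import Relation.Binary.PropositionalEquality

private
  variable
    n b : ℕ

bit : Bool → Fin 2
bit false = zero
bit true  = suc zero

bit-injective : Injective _≡_ _≡_ bit
bit-injective {false} {false} _ = refl
bit-injective {true}  {true}  _ = refl

-- Read S ∩ U as a binary number with one digit per element of U.
restriction-code : (U S : Subset n) → Fin (2 ^ ∣ U ∣)
restriction-code []            []      = zero
restriction-code (outside ∷ U) (_ ∷ S) = restriction-code U S
restriction-code (inside ∷ U)  (s ∷ S) = combine (bit s) (restriction-code U S)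

restriction-code-injective : (U S S′ : Subset n) →
  restriction-code U S ≡ restriction-code U S′ → S ∩ U ≡ S′ ∩ U
restriction-code-injective [] [] [] _ = refl
restriction-code-injective (outside ∷ U) (s ∷ S) (s′ ∷ S′) eq =
  cong₂ _∷_ (trans (∧-zeroʳ s) (sym (∧-zeroʳ s′)))
            (restriction-code-injective U S S′ eq)
restriction-code-injective (inside ∷ U) (s ∷ S) (s′ ∷ S′) eq
  with bits , codes ← combine-injective (bit s) _ (bit s′) _ eq =
  cong₂ _∷_ (trans (∧-identityʳ s) (trans (bit-injective bits) (sym (∧-identityʳ s′))))
            (restriction-code-injective U S S′ codes)

p∩r≡q∩r∧x∈p∧x∈r⇒x∈q : {z : Fin n} (U S S′ : Subset n) → S ∩ U ≡ S′ ∩ U → z ∈ S → z ∈ U → z ∈ S′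
p∩r≡q∩r∧x∈p∧x∈r⇒x∈q {z = z} U S S′ eq z∈S z∈U =
  proj₁ (x∈p∩q⁻ S′ U (subst (z ∈_) eq (x∈p∩q⁺ (z∈S , z∈U))))

2+∣p-x-y∣≤∣p∣ : {p : Subset n} {x y : Fin n} →
  x ∈ p → y ∈ p → x ≢ y → 2 + ∣ p - x - y ∣ ≤ ∣ p ∣
2+∣p-x-y∣≤∣p∣ x∈p y∈p x≢y =
  ≤-trans (s≤s (x∈p⇒∣p-x∣<∣p∣ (x∈p∧x≢y⇒x∈p-y y∈p (x≢y ∘ sym)))) (x∈p⇒∣p-x∣<∣p∣ x∈p)

module _ (T : Subset n) (x y : Fin n) where

  -- Sets with x ∈ S and y ∉ S share a code with those having x, y ∈ S: only the
  -- three patterns compatible with x ∈ S ⇒ y ∈ S need to be told apart.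
  pattern-code : Subset n → Fin 3
  pattern-code S with x ∈? S | y ∈? S
  ... | no _  | no _  = zero
  ... | no _  | yes _ = suc zero
  ... | yes _ | _     = suc (suc zero)

  pattern-code-⊆ : (S S′ : Subset n) → (x ∈ S′ → y ∈ S′) →
    pattern-code S ≡ pattern-code S′ → (x ∈ S → x ∈ S′) × (y ∈ S → y ∈ S′)
  pattern-code-⊆ S S′ closed eq with x ∈? S | y ∈? S | x ∈? S′ | y ∈? S′
  ... | yes _   | _       | yes x∈S′ | _        = (λ _ → x∈S′) , (λ _ → closed x∈S′)
  ... | no x∉S  | no y∉S  | no _     | no _     = ⊥-elim ∘ x∉S , ⊥-elim ∘ y∉S
  ... | no x∉S  | yes _   | no _     | yes y∈S′ = ⊥-elim ∘ x∉S , (λ _ → y∈S′)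
  pattern-code-⊆ S S′ closed () | yes _   | _       | no _     | no _
  pattern-code-⊆ S S′ closed () | yes _   | _       | no _     | yes _
  pattern-code-⊆ S S′ closed () | no _    | no _    | yes _    | _
  pattern-code-⊆ S S′ closed () | no _    | yes _   | yes _    | _
  pattern-code-⊆ S S′ closed () | no _    | no _    | no _     | yes _
  pattern-code-⊆ S S′ closed () | no _    | yes _   | no _     | no _

  code : Subset n → Fin (3 * 2 ^ ∣ T - x - y ∣)
  code S = combine (pattern-code S) (restriction-code (T - x - y) S)

  ⊆-by-parts : (S S′ : Subset n) → S ⊆ T → (x ∈ S′ → y ∈ S′) →
    pattern-code S ≡ pattern-code S′ → S ∩ (T - x - y) ≡ S′ ∩ (T - x - y) → S ⊆ S′
  ⊆-by-parts S S′ S⊆T closed patterns restrictions {z} z∈S with z ≟ x | z ≟ y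
  ... | yes refl | _        = proj₁ (pattern-code-⊆ S S′ closed patterns) z∈S
  ... | no _     | yes refl = proj₂ (pattern-code-⊆ S S′ closed patterns) z∈S
  ... | no z≢x   | no z≢y   = p∩r≡q∩r∧x∈p∧x∈r⇒x∈q (T - x - y) S S′ restrictions z∈S
    (x∈p∧x≢y⇒x∈p-y (x∈p∧x≢y⇒x∈p-y (S⊆T z∈S) z≢x) z≢y)

  code-⊆ : (S S′ : Subset n) → S ⊆ T → (x ∈ S′ → y ∈ S′) → code S ≡ code S′ → S ⊆ S′
  code-⊆ S S′ S⊆T closed eq
    with patterns , restrictions ← combine-injective (pattern-code S) _ (pattern-code S′) _ eq =
    ⊆-by-parts S S′ S⊆T closed patterns
      (restriction-code-injective (T - x - y) S S′ restrictions)

  pattern-avoiding-family-bound : (H : Fin b → Subset n) → IsFamily H →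
    (∀ i → H i ⊆ T) → (∀ i → x ∈ H i → y ∈ H i) → b ≤ 3 * 2 ^ ∣ T - x - y ∣
  pattern-avoiding-family-bound H H-family H⊆T closed = injective⇒≤ λ {i} {j} eq →
    H-family i j (⊆-antisym (code-⊆ (H i) (H j) (H⊆T i) (closed j) eq)
                            (code-⊆ (H j) (H i) (H⊆T j) (closed i) (sym eq)))

separates-or-closed : {k : ℕ} (F : Fin k → Subset n) (x y : Fin n) →
  (Σ (Fin k) λ i → x ∈ F i × y ∉ F i) ⊎ (∀ i → x ∈ F i → y ∈ F i)
separates-or-closed F x y with any? (λ i → (x ∈? F i) ×-dec ¬? (y ∈? F i))
... | yes separating = inj₁ separating
... | no ¬separating = inj₂ λ i x∈Fi →
  decidable-stable (y ∈? F i) (λ y∉Fi → ¬separating (i , x∈Fi , y∉Fi))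

2^[2+s]∸2^s+1≡1+3*2^s : (s : ℕ) → 2 ^ (2 + s) ∸ 2 ^ s + 1 ≡ suc (3 * 2 ^ s)
2^[2+s]∸2^s+1≡1+3*2^s s = begin
  2 ^ (2 + s) ∸ 2 ^ s + 1       ≡⟨ cong (λ w → w ∸ 2 ^ s + 1) (four-times (2 ^ s)) ⟩
  2 ^ s + 3 * 2 ^ s ∸ 2 ^ s + 1 ≡⟨ cong (_+ 1) (m+n∸m≡n (2 ^ s) (3 * 2 ^ s)) ⟩
  3 * 2 ^ s + 1                 ≡⟨ +-comm (3 * 2 ^ s) 1 ⟩
  suc (3 * 2 ^ s)               ∎
  where
  open ≡-Reasoning
  four-times : (a : ℕ) → 2 * (2 * a) ≡ a + 3 * a
  four-times = solve-∀

lemma13 : (n m t : ℕ) → 2 ≤ t → t ≤ n → 1 ≤ m →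
    Arrow n m t (2 ^ t ∸ 2 ^ (t ∸ 2) + 1) →
    (k : ℕ) → m ≤ k → (F : Fin k → Subset n) → IsFamily F →
    Separable t F
lemma13 n m (suc (suc s)) (s≤s (s≤s _)) _ _ arrow k m≤k F F-family
  with T , ∣T∣≡2+s , g , g-traces-distinct ←
         arrow (λ i → F (inject≤ i m≤k)) (λ i j → inject≤-injective m≤k m≤k i j ∘ F-family _ _)
  = T , ∣T∣≡2+s , separating
  where
  separating : (x y : Fin n) → x ∈ T → y ∈ T → x ≢ y →
    Σ (Fin k) λ i → x ∈ F i × y ∉ F i
  separating x y x∈T y∈T x≢y with separates-or-closed F x y
  ... | inj₁ separates = separates
  ... | inj₂ closed    = ⊥-elim (<-irrefl refl (begin-strict
    3 * 2 ^ s                 <⟨ n<1+n (3 * 2 ^ s) ⟩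
    suc (3 * 2 ^ s)           ≡⟨ 2^[2+s]∸2^s+1≡1+3*2^s s ⟨
    2 ^ (2 + s) ∸ 2 ^ s + 1   ≤⟨ pattern-avoiding-family-bound T x y traces g-traces-distinct
                                   (λ i → proj₂ ∘ x∈p∩q⁻ _ T) traces-closed ⟩
    3 * 2 ^ ∣ T - x - y ∣     ≤⟨ *-monoʳ-≤ 3 (^-monoʳ-≤ 2 ∣T-x-y∣≤s) ⟩
    3 * 2 ^ s                 ∎))
    where
    open ≤-Reasoning
    traces : Fin (2 ^ (2 + s) ∸ 2 ^ s + 1) → Subset n
    traces i = F (inject≤ (g i) m≤k) ∩ T
    traces-closed : ∀ i → x ∈ traces i → y ∈ traces i
    traces-closed i x∈ = x∈p∩q⁺ (closed _ (proj₁ (x∈p∩q⁻ _ T x∈)) , y∈T)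
    ∣T-x-y∣≤s : ∣ T - x - y ∣ ≤ s
    ∣T-x-y∣≤s = ℕ.≤-pred (ℕ.≤-pred
      (subst (2 + ∣ T - x - y ∣ ≤_) ∣T∣≡2+s (2+∣p-x-y∣≤∣p∣ x∈T y∈T x≢y)))
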